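{- In the theory of states $T_{sta}$: (1) for each accessor $a:X\to Y$, either $a$ is pure or there is a pure $v:V\to Y$ such that $a\equiv v\circ\mathtt{lookup}\circ\langle\,\rangle_X$; and for each accessor $a:\mathbb{1}\to Y$ (pure or not) there is a pure $v:V\to Y$ such that $a\equiv v\circ\mathtt{lookup}$; (2) for each modifier $f:X\to Y$, either $f$ is an accessor or there are an accessor $a:X\to V$ and a pure term $u:V\to Y$ such that $f\equiv u\circ\mathtt{lookup}\circ\mathtt{update}\circ a$.
   Context: Monadic equational logic with constants $L_{eqn,1}$: types and terms generated by a signature of unary operations, terms being composable paths (with identities); a unit type $\mathbb{1}$ with a term $\langle\,\rangle_X:X\to\mathbb{1}$ for each $X$. Rules: $\equiv$ is an equivalence relation; (subs) from $v_1\equiv v_2:Y\to Z$ and $u:X\to Y$ infer $v_1\circ u\equiv v_2\circ u$; (repl) from $v_1\equiv v_2:X\to Y$ and $w:Y\to Z$ infer $w\circ v_1\equiv w\circ v_2$; (unit) every $f:X\to\mathbb{1}$ satisfies $f\equiv\langle\,\rangle_X$. Decorated logic for states $L_{sta}$: pure part a logic $L_{sta}^{(0)}$ extending $L_{eqn,1}$ with a distinguished type $V$ (pure terms, decoration $(0)$). Terms of $L_{sta}$ are composites of pure terms, $\mathtt{lookup}:\mathbb{1}\to V$ (decoration $(1)$) and $\mathtt{update}:V\to\mathbb{1}$ (decoration $(2)$); decoration of a composite is the maximum; accessors are terms of decoration at most $(1)$; all terms are modifiers. Formulas: strong equations $f\equiv g$ and weak equations $f\sim g$. Rules: for $\equiv$: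 equivalence, (subs), (repl) for all decorations; for $\sim$: equivalence and (subs) for all decorations, (repl) only when the outer term is pure; (unit$_\sim$) every $f:X\to\mathbb{1}$ satisfies $f\sim\langle\,\rangle_X$; $f\equiv g$ implies $f\sim g$; (ax) $\mathtt{lookup}\circ\mathtt{update}\sim\mathrm{id}_V$; (eq$_1$) $f_1\sim f_2$ with $f_1,f_2$ accessors implies $f_1\equiv f_2$; (eq$_2$) for $f_1,f_2:X\to Y$, $f_1\sim f_2$ and $\langle\,\rangle_Y\circ f_1\equiv\langle\,\rangle_Y\circ f_2$ imply $f_1\equiv f_2$; (eq$_3$) for $f_1,f_2:X\to\mathbb{1}$, $\mathtt{lookup}\circ f_1\sim\mathtt{lookup}\circ f_2$ implies $f_1\equiv f_2$; plus the rules of $L_{sta}^{(0)}$ for pure terms. $T_{sta}$ is the theory of $L_{sta}$ generated by a fixed theory $T^{(0)}$ of $L_{sta}^{(0)}$; the equations in the claim are theorems of $T_{sta}$. -}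

module Defs where

open import Data.Nat using (ℕ; _⊔_; _≤_)
open import Relation.Binary.PropositionalEquality using (_≡_)

data Ty (S : Set) : Set where
  base : S → Ty S
  𝟙    : Ty S

-- The syntax of L_sta over a signature: base sorts S, unary operation
-- symbols Op X Y (of L_sta^(0)), and a distinguished type V.
module Sta (S : Set) (Op : Ty S → Ty S → Set) (V : Ty S) where

  data Atom : Ty S → Ty S → Set where
    op       : ∀ {X Y} → Op X Y → Atom X Y
    bang     : (X : Ty S) → Atom X 𝟙
    lookupA  : Atom 𝟙 V
    updateA  : Atom V 𝟙

  -- terms are composable paths of atoms (with identities);
  -- a · p  means  a ∘ p
  infixr 5 _·_
  data Tm : Ty S → Ty S → Set where
    idt : ∀ {X} → Tm X X
    _·_ : ∀ {X Y Z} → Atom Y Z → Tm X Y → Tm X Z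

  infixr 9 _∘_
  _∘_ : ∀ {X Y Z} → Tm Y Z → Tm X Y → Tm X Z
  idt ∘ u     = u
  (a · p) ∘ u = a · (p ∘ u)

  ⟨⟩ : (X : Ty S) → Tm X 𝟙
  ⟨⟩ X = bang X · idt

  lookup : Tm 𝟙 V
  lookup = lookupA · idt

  update : Tm V 𝟙
  update = updateA · idt

  -- decorations: 0 = pure, 1 = accessor, 2 = modifier
  decoA : ∀ {X Y} → Atom X Y → ℕ
  decoA (op _)   = 0
  decoA (bang _) = 0
  decoA lookupA  = 1
  decoA updateA  = 2

  deco : ∀ {X Y} → Tm X Y → ℕ
  deco idt     = 0
  deco (a · p) = decoA a ⊔ deco p

  IsPure : ∀ {X Y} → Tm X Y → Set
  IsPure f = deco f ≡ 0

  IsAccessor : ∀ {X Y} → Tm X Y → Set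
  IsAccessor f = deco f ≤ 1

  -- The theory T_sta generated by a set Ax of (pure) equations of L_sta^(0):
  -- strong (≡ˢ) and weak (∼ʷ) equations derivable by the rules of L_sta.
  module Theory (Ax : ∀ {X Y} → Tm X Y → Tm X Y → Set) where

    infix 4 _≡ˢ_ _∼ʷ_
    data _≡ˢ_ : ∀ {X Y} → Tm X Y → Tm X Y → Set
    data _∼ʷ_ : ∀ {X Y} → Tm X Y → Tm X Y → Set

    data _≡ˢ_ where
      ax     : ∀ {X Y} {f g : Tm X Y} → Ax f g → f ≡ˢ g
      refl   : ∀ {X Y} {f : Tm X Y} → f ≡ˢ f
      sym    : ∀ {X Y} {f g : Tm X Y} → f ≡ˢ g → g ≡ˢ f
      trans  : ∀ {X Y} {f g h : Tm X Y} → f ≡ˢ g → g ≡ˢ h → f ≡ˢ h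
      subs   : ∀ {X Y Z} {v₁ v₂ : Tm Y Z} (u : Tm X Y) →
               v₁ ≡ˢ v₂ → v₁ ∘ u ≡ˢ v₂ ∘ u
      repl   : ∀ {X Y Z} {v₁ v₂ : Tm X Y} (w : Tm Y Z) →
               v₁ ≡ˢ v₂ → w ∘ v₁ ≡ˢ w ∘ v₂
      unit   : ∀ {X} (f : Tm X 𝟙) → IsPure f → f ≡ˢ ⟨⟩ X
      eq₁    : ∀ {X Y} {f₁ f₂ : Tm X Y} → IsAccessor f₁ → IsAccessor f₂ →
               f₁ ∼ʷ f₂ → f₁ ≡ˢ f₂
      eq₂    : ∀ {X Y} {f₁ f₂ : Tm X Y} → f₁ ∼ʷ f₂ →
               ⟨⟩ Y ∘ f₁ ≡ˢ ⟨⟩ Y ∘ f₂ → f₁ ≡ˢ f₂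
      eq₃    : ∀ {X} {f₁ f₂ : Tm X 𝟙} → lookup ∘ f₁ ∼ʷ lookup ∘ f₂ →
               f₁ ≡ˢ f₂

    data _∼ʷ_ where
      refl   : ∀ {X Y} {f : Tm X Y} → f ∼ʷ f
      sym    : ∀ {X Y} {f g : Tm X Y} → f ∼ʷ g → g ∼ʷ f
      trans  : ∀ {X Y} {f g h : Tm X Y} → f ∼ʷ g → g ∼ʷ h → f ∼ʷ h
      subs   : ∀ {X Y Z} {v₁ v₂ : Tm Y Z} (u : Tm X Y) →
               v₁ ∼ʷ v₂ → v₁ ∘ u ∼ʷ v₂ ∘ u
      repl   : ∀ {X Y Z} {v₁ v₂ : Tm X Y} (w : Tm Y Z) → IsPure w →
               v₁ ∼ʷ v₂ → w ∘ v₁ ∼ʷ w ∘ v₂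
      unit   : ∀ {X} (f : Tm X 𝟙) → f ∼ʷ ⟨⟩ X
      strong : ∀ {X Y} {f g : Tm X Y} → f ≡ˢ g → f ∼ʷ g
      ax     : lookup ∘ update ∼ʷ idt

-- Accessors: two accessors into 𝟙 are weakly equal by (unit), hence strongly
-- equal by (eq₁); so whatever precedes the outermost lookup may be replaced
-- by ⟨⟩, and a pure u : V → 𝟙 satisfies u ∘ lookup ≡ id.
-- Modifiers: the latter gives update ≡ ⟨⟩ ∘ lookup ∘ update (the base case)
-- and absorbs a lookup stacked on the normal form; an update stacked on it
-- is absorbed by update ∘ u ∘ lookup ∘ update ≡ update ∘ u, which holds by
-- (eq₃) because lookup ∘ update ∼ id.
module Submission where

open import Defs
open import Data.Product using (Σ; _×_; _,_)
open import Data.Sum using (_⊎_; inj₁; inj₂)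
open import Data.Nat using (_⊔_; z≤n; s≤s)
open import Data.Nat.Properties using (⊔-assoc; m≤m⊔n; m≤n⊔m; ≤-trans; ⊔-lub)
open import Data.Empty using (⊥; ⊥-elim)
open import Relation.Binary.Bundles using (Setoid)
import Relation.Binary.PropositionalEquality as P
import Relation.Binary.Reasoning.Setoid as SetoidReasoning

module Terms (S : Set) (Op : Ty S → Ty S → Set) (V : Ty S) where
  open Sta S Op V

  ∘-identityʳ : ∀ {X Y} (f : Tm X Y) → f ∘ idt P.≡ f
  ∘-identityʳ idt     = P.refl
  ∘-identityʳ (a · f) = P.cong (a ·_) (∘-identityʳ f)

  ∘-assoc : ∀ {W X Y Z} (f : Tm Y Z) (g : Tm X Y) (h : Tm W X) →
            (f ∘ g) ∘ h P.≡ f ∘ (g ∘ h)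
  ∘-assoc idt     g h = P.refl
  ∘-assoc (a · f) g h = P.cong (a ·_) (∘-assoc f g h)

  deco-∘ : ∀ {X Y Z} (f : Tm Y Z) (g : Tm X Y) → deco (f ∘ g) P.≡ deco f ⊔ deco g
  deco-∘ idt     g = P.refl
  deco-∘ (a · f) g = P.trans (P.cong (decoA a ⊔_) (deco-∘ f g))
                             (P.sym (⊔-assoc (decoA a) (deco f) (deco g)))

  IsPure-∘ : ∀ {X Y Z} (f : Tm Y Z) (g : Tm X Y) →
             IsPure f → IsPure g → IsPure (f ∘ g)
  IsPure-∘ f g pf pg rewrite deco-∘ f g | pf | pg = P.refl

  IsAccessor-∘ : ∀ {X Y Z} (f : Tm Y Z) (g : Tm X Y) →
                 IsAccessor f → IsAccessor g → IsAccessor (f ∘ g)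
  IsAccessor-∘ f g af ag rewrite deco-∘ f g = ⊔-lub af ag

  IsPure⇒IsAccessor : ∀ {X Y} (f : Tm X Y) → IsPure f → IsAccessor f
  IsPure⇒IsAccessor f pf rewrite pf = z≤n

  IsAccessor-tail : ∀ {X Y Z} (a : Atom Y Z) (p : Tm X Y) →
                    IsAccessor (a · p) → IsAccessor p
  IsAccessor-tail a p = ≤-trans (m≤n⊔m (decoA a) (deco p))

  update-¬IsAccessor : ∀ {X} (p : Tm X V) → IsAccessor (updateA · p) → ⊥
  update-¬IsAccessor p h with ≤-trans (m≤m⊔n 2 (deco p)) h
  ... | s≤s ()

  lookup-IsAccessor : IsAccessor lookup
  lookup-IsAccessor = s≤s z≤n

module Normalisation (S : Set) (Op : Ty S → Ty S → Set) (V : Ty S)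
                     (Ax : ∀ {X Y} → Sta.Tm S Op V X Y → Sta.Tm S Op V X Y → Set) where
  open Sta S Op V
  open Terms S Op V
  open Theory Ax

  ≡ˢ-setoid : Ty S → Ty S → Setoid _ _
  ≡ˢ-setoid X Y = record
    { Carrier       = Tm X Y
    ; _≈_           = _≡ˢ_
    ; isEquivalence = record { refl = refl ; sym = sym ; trans = trans }
    }

  ∼ʷ-setoid : Ty S → Ty S → Setoid _ _
  ∼ʷ-setoid X Y = record
    { Carrier       = Tm X Y
    ; _≈_           = _∼ʷ_
    ; isEquivalence = record { refl = refl ; sym = sym ; trans = trans }
    }

  module ≡ˢ-Reasoning {X Y : Ty S} = SetoidReasoning (≡ˢ-setoid X Y)
  module ∼ʷ-Reasoning {X Y : Ty S} = SetoidReasoning (∼ʷ-setoid X Y)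

  accessors-into-𝟙-equal : ∀ {X} {f g : Tm X 𝟙} →
                           IsAccessor f → IsAccessor g → f ≡ˢ g
  accessors-into-𝟙-equal {f = f} {g} af ag = eq₁ af ag (trans (unit f) (sym (unit g)))

  pure∘lookup≡ˢid : (u : Tm V 𝟙) → IsPure u → u ∘ lookup ≡ˢ idt
  pure∘lookup≡ˢid u pu = accessors-into-𝟙-equal
    (IsAccessor-∘ u lookup (IsPure⇒IsAccessor u pu) lookup-IsAccessor) z≤n

  update≡ˢ⟨⟩∘lookup∘update : ∀ {X} (p : Tm X V) →
                             update ∘ p ≡ˢ ⟨⟩ V ∘ lookup ∘ update ∘ p
  update≡ˢ⟨⟩∘lookup∘update p = sym (subs (update ∘ p) (pure∘lookup≡ˢid (⟨⟩ V) P.refl))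

  update∘pure∘lookup∘update : (u : Tm V V) → IsPure u →
                              update ∘ u ∘ lookup ∘ update ≡ˢ update ∘ u
  update∘pure∘lookup∘update u pu = eq₃ (begin
    (lookup ∘ update) ∘ u ∘ lookup ∘ update  ≈⟨ subs (u ∘ lookup ∘ update) ax ⟩
    u ∘ lookup ∘ update                      ≈⟨ repl u pu ax ⟩
    u ∘ idt                                  ≡⟨ ∘-identityʳ u ⟩
    u                                        ≈⟨ subs u ax ⟨
    (lookup ∘ update) ∘ u                    ∎)
    where open ∼ʷ-Reasoning

  AccessorNormalForm : ∀ {X Y} → Tm X Y → Set
  AccessorNormalForm {X} {Y} a = Σ (Tm V Y) (λ v → IsPure v × (a ≡ˢ v ∘ lookup ∘ ⟨⟩ X))

  ModifierNormalForm : ∀ {X Y} → Tm X Y → Set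
  ModifierNormalForm {X} {Y} f = Σ (Tm X V) (λ a → Σ (Tm V Y) (λ u →
    IsAccessor a × IsPure u × (f ≡ˢ u ∘ lookup ∘ update ∘ a)))

  AccessorNormalForm-pure∘ : ∀ {X Y Z} (w : Tm Y Z) {a : Tm X Y} →
                             IsPure w → AccessorNormalForm a → AccessorNormalForm (w ∘ a)
  AccessorNormalForm-pure∘ {X} w {a} pw (v , pv , a≡) = w ∘ v , IsPure-∘ w v pw pv , (begin
    w ∘ a                      ≈⟨ repl w a≡ ⟩
    w ∘ v ∘ lookup ∘ ⟨⟩ X      ≡⟨ ∘-assoc w v (lookup ∘ ⟨⟩ X) ⟨
    (w ∘ v) ∘ lookup ∘ ⟨⟩ X    ∎)
    where open ≡ˢ-Reasoning

  accessor-normal-form : ∀ {X Y} (a : Tm X Y) → IsAccessor a →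
                         IsPure a ⊎ AccessorNormalForm a
  accessor-normal-form idt _ = inj₁ P.refl
  accessor-normal-form (op o · p) h with accessor-normal-form p h
  ... | inj₁ pp = inj₁ pp
  ... | inj₂ nf = inj₂ (AccessorNormalForm-pure∘ (op o · idt) P.refl nf)
  accessor-normal-form (bang Z · p) h with accessor-normal-form p h
  ... | inj₁ pp = inj₁ pp
  ... | inj₂ nf = inj₂ (AccessorNormalForm-pure∘ (bang Z · idt) P.refl nf)
  accessor-normal-form (lookupA · p) h =
    inj₂ (idt , P.refl , repl lookup (accessors-into-𝟙-equal (IsAccessor-tail lookupA p h) z≤n))
  accessor-normal-form (updateA · p) h = ⊥-elim (update-¬IsAccessor p h)

  accessor-from-𝟙-normal-form : ∀ {Y} (a : Tm 𝟙 Y) → IsAccessor a →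
                                Σ (Tm V Y) (λ v → IsPure v × (a ≡ˢ v ∘ lookup))
  accessor-from-𝟙-normal-form a h with accessor-normal-form a h
  ... | inj₂ (v , pv , a≡) =
    v , pv , trans a≡ (repl v (repl lookup (accessors-into-𝟙-equal z≤n z≤n)))
  ... | inj₁ pa = a ∘ ⟨⟩ V , IsPure-∘ a (⟨⟩ V) pa P.refl , (begin
    a                      ≡⟨ ∘-identityʳ a ⟨
    a ∘ idt                ≈⟨ repl a (pure∘lookup≡ˢid (⟨⟩ V) P.refl) ⟨
    a ∘ ⟨⟩ V ∘ lookup      ≡⟨ ∘-assoc a (⟨⟩ V) lookup ⟨
    (a ∘ ⟨⟩ V) ∘ lookup    ∎)
    where open ≡ˢ-Reasoning

  ModifierNormalForm-pure∘ : ∀ {X Y Z} (w : Tm Y Z) {f : Tm X Y} →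
                             IsPure w → ModifierNormalForm f → ModifierNormalForm (w ∘ f)
  ModifierNormalForm-pure∘ w {f} pw (a , u , aa , pu , f≡) =
    a , w ∘ u , aa , IsPure-∘ w u pw pu , (begin
    w ∘ f                               ≈⟨ repl w f≡ ⟩
    w ∘ u ∘ lookup ∘ update ∘ a         ≡⟨ ∘-assoc w u (lookup ∘ update ∘ a) ⟨
    (w ∘ u) ∘ lookup ∘ update ∘ a       ∎)
    where open ≡ˢ-Reasoning

  ModifierNormalForm-lookup∘ : ∀ {X} {f : Tm X 𝟙} →
                               ModifierNormalForm f → ModifierNormalForm (lookup ∘ f)
  ModifierNormalForm-lookup∘ {f = f} (a , u , aa , pu , f≡) =
    a , idt , aa , P.refl , (begin
    lookup ∘ f                              ≈⟨ repl lookup f≡ ⟩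
    lookup ∘ u ∘ lookup ∘ update ∘ a        ≡⟨ P.cong (lookup ∘_) (∘-assoc u lookup (update ∘ a)) ⟨
    lookup ∘ (u ∘ lookup) ∘ update ∘ a      ≈⟨ repl lookup (subs (update ∘ a) (pure∘lookup≡ˢid u pu)) ⟩
    lookup ∘ update ∘ a                     ∎)
    where open ≡ˢ-Reasoning

  ModifierNormalForm-update∘ : ∀ {X} {f : Tm X V} →
                               ModifierNormalForm f → ModifierNormalForm (update ∘ f)
  ModifierNormalForm-update∘ {f = f} (a , u , aa , pu , f≡) =
    u ∘ a , ⟨⟩ V , IsAccessor-∘ u a (IsPure⇒IsAccessor u pu) aa , P.refl , (begin
    update ∘ f                              ≈⟨ repl update f≡ ⟩
    update ∘ u ∘ lookup ∘ update ∘ a        ≡⟨ P.cong (update ∘_) (∘-assoc u (lookup ∘ update) a) ⟨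
    update ∘ (u ∘ lookup ∘ update) ∘ a      ≈⟨ subs a (update∘pure∘lookup∘update u pu) ⟩
    update ∘ u ∘ a                          ≈⟨ update≡ˢ⟨⟩∘lookup∘update (u ∘ a) ⟩
    ⟨⟩ V ∘ lookup ∘ update ∘ u ∘ a          ∎)
    where open ≡ˢ-Reasoning

  modifier-normal-form : ∀ {X Y} (f : Tm X Y) → IsAccessor f ⊎ ModifierNormalForm f
  modifier-normal-form idt = inj₁ z≤n
  modifier-normal-form (op o · p) with modifier-normal-form p
  ... | inj₁ ap = inj₁ ap
  ... | inj₂ nf = inj₂ (ModifierNormalForm-pure∘ (op o · idt) P.refl nf)
  modifier-normal-form (bang Z · p) with modifier-normal-form p
  ... | inj₁ ap = inj₁ ap
  ... | inj₂ nf = inj₂ (ModifierNormalForm-pure∘ (bang Z · idt) P.refl nf)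
  modifier-normal-form (lookupA · p) with modifier-normal-form p
  ... | inj₁ ap = inj₁ (IsAccessor-∘ lookup p lookup-IsAccessor ap)
  ... | inj₂ nf = inj₂ (ModifierNormalForm-lookup∘ nf)
  modifier-normal-form (updateA · p) with modifier-normal-form p
  ... | inj₁ ap = inj₂ (p , ⟨⟩ V , ap , P.refl , update≡ˢ⟨⟩∘lookup∘update p)
  ... | inj₂ nf = inj₂ (ModifierNormalForm-update∘ nf)

propositionA2 : (S : Set) (Op : Ty S → Ty S → Set) (V : Ty S)
    → let open Sta S Op V in
      (Ax : ∀ {X Y} → Tm X Y → Tm X Y → Set)
    → (∀ {X Y} {f g : Tm X Y} → Ax f g → IsPure f × IsPure g)
    → let open Theory Ax in
      ((∀ {X Y} (a : Tm X Y) → IsAccessor a →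
          IsPure a ⊎ Σ (Tm V Y) (λ v → IsPure v × (a ≡ˢ v ∘ lookup ∘ ⟨⟩ X)))
       × (∀ {Y} (a : Tm 𝟙 Y) → IsAccessor a →
          Σ (Tm V Y) (λ v → IsPure v × (a ≡ˢ v ∘ lookup))))
      × (∀ {X Y} (f : Tm X Y) →
          IsAccessor f ⊎
          Σ (Tm X V) (λ a → Σ (Tm V Y) (λ u →
            IsAccessor a × IsPure u × (f ≡ˢ u ∘ lookup ∘ update ∘ a))))
propositionA2 S Op V Ax _ =
  (accessor-normal-form , accessor-from-𝟙-normal-form) , modifier-normal-form
  where open Normalisation S Op V Ax
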